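{- Let $\mathcal{H}$ be a hypergraph on $n$ vertices with $nd$ edges. Then there exists a sub-hypergraph $\mathcal{H}'\subseteq\mathcal{H}$ with at least $nd/2$ edges which has a $(d/2,1)$-bucket decomposition.
   Context: Given a hypergraph $\mathcal{H}$, a bucket is a pair $(\mathcal{E},X)$ where $\mathcal{E}$ is a set of edges of $\mathcal{H}$ all of which contain the vertex set $X\subseteq V(\mathcal{H})$. An $(m,t)$-bucket decomposition of $\mathcal{H}$ is a partition of the edge set of $\mathcal{H}$ into buckets $(\mathcal{E}_1,X_1),(\mathcal{E}_2,X_2),\ldots$ with $|\mathcal{E}_i|=m$ and $|X_i|=t$ for all $i$. -}

module Defs where

open import Data.Nat using (ℕ; _*_; _≤_)
open import Data.Fin using (Fin)
open import Data.Fin.Subset using (Subset; _⊆_; ∣_∣)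
open import Data.List using (List; length; map; concat)
open import Data.List.Relation.Unary.All using (All)
open import Data.List.Relation.Unary.Unique.Propositional using (Unique)
import Data.List.Membership.Propositional as LM
open import Data.List.Relation.Binary.Permutation.Propositional using (_↭_)
open import Relation.Binary.PropositionalEquality using (_≡_)

record Hypergraph (n : ℕ) : Set where
  field
    edges  : List (Subset n)
    unique : Unique edges
open Hypergraph public

∣E∣ : ∀ {n} → Hypergraph n → ℕ
∣E∣ H = length (edges H)

_⊆H_ : ∀ {n} → Hypergraph n → Hypergraph n → Set
H' ⊆H H = All (λ e → e LM.∈ edges H) (edges H')

record Bucket (n : ℕ) : Set where
  field
    bedges   : List (Subset n)
    bverts   : Subset n
    contains : All (λ e → bverts ⊆ e) bedges
open Bucket public

-- An (m,t)-bucket decomposition of H: a list of buckets, each with exactly m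
-- edges and exactly t vertices, whose edge sets partition the edge set of H
-- (the concatenation of the bucket edge lists is a permutation of edges H;
-- since edges H has no duplicates, the buckets are pairwise disjoint).
record BucketDecomposition {n : ℕ} (m t : ℕ) (H : Hypergraph n) : Set where
  field
    buckets   : List (Bucket n)
    sizeE     : All (λ B → length (bedges B) ≡ m) buckets
    sizeX     : All (λ B → ∣ bverts B ∣ ≡ t) buckets
    partition : concat (map bedges buckets) ↭ edges H

{-# OPTIONS --safe #-}
-- Write d = 2k and treat the vertices one after another: at a vertex v, cut
-- the still available edges through v into blocks of k, each block forming a
-- bucket with vertex set {v}; fewer than k of these edges are lost. After all
-- n vertices the only edges left contain no vertex, i.e. they are the empty
-- edge, which occurs at most once. So at most n(k - 1) + 1 ≤ nk of the 2nk
-- edges are lost.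
module Submission where

open import Defs
open import Data.Nat using (ℕ; _*_; _≤_)
open import Data.Product using (Σ; _×_)
open import Relation.Binary.PropositionalEquality using (_≡_)

open import Level using (Level)
open import Data.Bool using (true; false)
open import Data.Nat using (zero; suc; _+_; z≤n; s≤s)
open import Data.Nat.Properties
  using (≤-reflexive; ≤-trans; +-mono-≤; +-monoˡ-≤; +-monoʳ-≤; +-cancelʳ-≤; +-identityʳ; +-comm;
         *-zeroʳ; *-suc; *-distribˡ-+; m≤n⇒m<n∨m≡n; module ≤-Reasoning)
open import Data.Product using (_,_; proj₁; proj₂; uncurry)
open import Data.Sum using (inj₁; inj₂)
open import Data.Fin using (Fin)
open import Data.Fin.Subset using (Subset; ⁅_⁆; ⊥; _∈_; _∉_; _⊆_; ∣_∣)
open import Data.Fin.Subset.Properties using (x∈⁅y⁆⇒x≡y; ∣⁅x⁆∣≡1; Empty-unique; _∈?_)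
open import Data.List using (List; []; _∷_; _++_; length; map; concat; filter; allFin)
import Data.List.Properties as List
open import Data.List.Relation.Unary.All as All using (All; []; _∷_)
import Data.List.Relation.Unary.All.Properties as All
open import Data.List.Relation.Unary.AllPairs using ([]; _∷_)
open import Data.List.Relation.Unary.Unique.Propositional using (Unique)
import Data.List.Relation.Binary.Permutation.Setoid.Properties as Permutationₛ
open import Data.List.Relation.Binary.Permutation.Propositional
  using (_↭_; ↭-refl; ↭-sym; ↭-trans; prep; ↭⇒↭ₛ; module PermutationReasoning)
open import Data.List.Relation.Binary.Permutation.Propositional.Properties
  using (shift; shifts; ++⁺; ++⁺ˡ; ++-comm; ↭-length; All-resp-↭; ∈-resp-↭)
open import Data.List.Membership.Propositional.Properties using (∈-++⁺ˡ; ∈-allFin)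
open import Function using (id)
open import Relation.Binary.PropositionalEquality using (refl; sym; trans; cong; cong₂; subst)
import Relation.Binary.PropositionalEquality as ≡
open import Relation.Nullary using (does)
open import Relation.Unary using (Pred; Decidable)
open import Relation.Unary.Properties using (∁?)

private
  variable
    a p : Level
    A : Set a

Unique-resp-↭ : {xs ys : List A} → xs ↭ ys → Unique xs → Unique ys
Unique-resp-↭ {A = A} xs↭ys = Permutationₛ.Unique-resp-↭ (≡.setoid A) (↭⇒↭ₛ xs↭ys)

Unique-++⁻ˡ : (xs : List A) {ys : List A} → Unique (xs ++ ys) → Unique xs
Unique-++⁻ˡ []       _           = []
Unique-++⁻ˡ (x ∷ xs) (x∉ ∷ uniq) = All.++⁻ˡ xs x∉ ∷ Unique-++⁻ˡ xs uniq

Unique-++⁻ʳ : (xs : List A) {ys : List A} → Unique (xs ++ ys) → Unique ys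
Unique-++⁻ʳ []       uniq       = uniq
Unique-++⁻ʳ (x ∷ xs) (_ ∷ uniq) = Unique-++⁻ʳ xs uniq

Unique∧constant⇒length≤1 : (c : A) (xs : List A) → Unique xs → All (_≡ c) xs → length xs ≤ 1
Unique∧constant⇒length≤1 c []          _               _               = z≤n
Unique∧constant⇒length≤1 c (_ ∷ [])    _               _               = s≤s z≤n
Unique∧constant⇒length≤1 c (_ ∷ _ ∷ _) ((x≢y ∷ _) ∷ _) (x≡c ∷ y≡c ∷ _)
  with () ← x≢y (trans x≡c (sym y≡c))

module _ {P : Pred A p} (P? : Decidable P) where

  filter-++-filter∁ : ∀ xs → filter P? xs ++ filter (∁? P?) xs ↭ xs
  filter-++-filter∁ []       = ↭-refl
  filter-++-filter∁ (x ∷ xs) with does (P? x)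
  ... | true  = prep x (filter-++-filter∁ xs)
  ... | false = ↭-trans (shift x (filter P? xs) _) (prep x (filter-++-filter∁ xs))

record Chunks {A : Set a} (k : ℕ) (xs : List A) : Set a where
  field
    blocks         : List (List A)
    remainder      : List A
    blocks-size    : All (λ b → length b ≡ suc k) blocks
    remainder-size : length remainder ≤ k
    reassemble     : remainder ++ concat blocks ≡ xs

chunk : (k : ℕ) (xs : List A) → Chunks k xs
chunk k []       = record
  { blocks = [] ; remainder = [] ; blocks-size = [] ; remainder-size = z≤n ; reassemble = refl }
chunk k (x ∷ xs) with c ← chunk k xs | m≤n⇒m<n∨m≡n (Chunks.remainder-size c)
... | inj₁ r<k = record
  { blocks         = blocks c
  ; remainder      = x ∷ remainder c
  ; blocks-size    = blocks-size c
  ; remainder-size = r<k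
  ; reassemble     = cong (x ∷_) (reassemble c)
  }
  where open Chunks
... | inj₂ r≡k = record
  { blocks         = (x ∷ remainder c) ∷ blocks c
  ; remainder      = []
  ; blocks-size    = cong suc r≡k ∷ blocks-size c
  ; remainder-size = z≤n
  ; reassemble     = cong (x ∷_) (reassemble c)
  }
  where open Chunks

module _ {n : ℕ} where

  x∈p⇒⁅x⁆⊆p : ∀ {x : Fin n} {p} → x ∈ p → ⁅ x ⁆ ⊆ p
  x∈p⇒⁅x⁆⊆p {x} x∈p y∈⁅x⁆ = subst (_∈ _) (sym (x∈⁅y⁆⇒x≡y x y∈⁅x⁆)) x∈p

  All∉allFin⇒≡⊥ : {e : Subset n} → All (_∉ e) (allFin n) → e ≡ ⊥
  All∉allFin⇒≡⊥ ∉e = Empty-unique (λ (x , x∈e) → All.lookup ∉e (∈-allFin x) x∈e)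

  bucketEdges : List (Bucket n) → List (Subset n)
  bucketEdges bs = concat (map bedges bs)

  bucketEdges-++ : (bs cs : List (Bucket n)) →
                   bucketEdges (bs ++ cs) ≡ bucketEdges bs ++ bucketEdges cs
  bucketEdges-++ bs cs =
    trans (cong concat (List.map-++ bedges bs cs)) (sym (List.concat-++ (map bedges bs) _))

  IsBucket : ℕ → ℕ → Bucket n → Set
  IsBucket m t B = length (bedges B) ≡ m × ∣ bverts B ∣ ≡ t

  star : (v : Fin n) {es : List (Subset n)} → All (v ∈_) es → Bucket n
  star v {es} v∈es = record { bedges = es ; bverts = ⁅ v ⁆ ; contains = All.map x∈p⇒⁅x⁆⊆p v∈es }

  stars : (v : Fin n) {ess : List (List (Subset n))} → All (All (v ∈_)) ess → List (Bucket n)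
  stars v = All.reduce (star v)

  bucketEdges-stars : ∀ v {ess} (v∈ess : All (All (v ∈_)) ess) →
                      bucketEdges (stars v v∈ess) ≡ concat ess
  bucketEdges-stars v []                   = refl
  bucketEdges-stars v {es ∷ _} (_ ∷ v∈ess) = cong (es ++_) (bucketEdges-stars v v∈ess)

  stars-IsBucket : ∀ {m} v {ess} → All (λ es → length es ≡ m) ess →
                   (v∈ess : All (All (v ∈_)) ess) → All (IsBucket m 1) (stars v v∈ess)
  stars-IsBucket v []            []          = []
  stars-IsBucket v (|es| ∷ sizes) (_ ∷ v∈ess) = (|es| , ∣⁅x⁆∣≡1 v) ∷ stars-IsBucket v sizes v∈ess

  record GreedyPacking (k : ℕ) (vs : List (Fin n)) (R : List (Subset n)) : Set where
    field
      buckets          : List (Bucket n)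
      shapes           : All (IsBucket (suc k) 1) buckets
      wasted           : List (Subset n)
      uncovered        : List (Subset n)
      covers           : bucketEdges buckets ++ wasted ++ uncovered ↭ R
      wasted-size      : length wasted ≤ length vs * k
      uncovered-avoids : All (λ e → All (_∉ e) vs) uncovered

  greedy : ∀ k vs R → GreedyPacking k vs R
  greedy k []       R = record
    { buckets          = []
    ; shapes           = []
    ; wasted           = []
    ; uncovered        = R
    ; covers           = ↭-refl
    ; wasted-size      = z≤n
    ; uncovered-avoids = All.tabulate (λ _ → [])
    }
  greedy k (v ∷ vs) R = record
    { buckets          = stars v v∈blocks ++ buckets
    ; shapes           = All.++⁺ (stars-IsBucket v blocks-size v∈blocks) shapes
    ; wasted           = remainder ++ wasted
    ; uncovered        = uncovered
    ; covers           = covers′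
    ; wasted-size      = ≤-trans (≤-reflexive (List.length-++ remainder))
                                 (+-mono-≤ remainder-size wasted-size)
    ; uncovered-avoids = All.zipWith (uncurry _∷_) (v∉uncovered , uncovered-avoids)
    }
    where
      through avoiding : List (Subset n)
      through  = filter (v ∈?_) R
      avoiding = filter (∁? (v ∈?_)) R
      open Chunks (chunk k through)
      open GreedyPacking (greedy k vs avoiding)

      v∈blocks : All (All (v ∈_)) blocks
      v∈blocks = All.concat⁻ (All.++⁻ʳ remainder
                   (subst (All (v ∈_)) (sym reassemble) (All.all-filter (v ∈?_) R)))

      v∉uncovered : All (v ∉_) uncovered
      v∉uncovered = All.++⁻ʳ wasted (All.++⁻ʳ (bucketEdges buckets)
                      (All-resp-↭ (↭-sym covers) (All.all-filter (∁? (v ∈?_)) R)))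

      S B : List (Subset n)
      S = bucketEdges (stars v v∈blocks)
      B = bucketEdges buckets

      covers′ : bucketEdges (stars v v∈blocks ++ buckets) ++ (remainder ++ wasted) ++ uncovered ↭ R
      covers′ = begin
        bucketEdges (stars v v∈blocks ++ buckets) ++ (remainder ++ wasted) ++ uncovered
          ≡⟨ cong₂ _++_ (bucketEdges-++ (stars v v∈blocks) buckets)
                        (List.++-assoc remainder wasted uncovered) ⟩
        (S ++ B) ++ remainder ++ wasted ++ uncovered
          ≡⟨ List.++-assoc S B _ ⟩
        S ++ B ++ remainder ++ wasted ++ uncovered
          ↭⟨ ++⁺ˡ S (shifts B remainder) ⟩
        S ++ remainder ++ B ++ wasted ++ uncovered
          ≡⟨ List.++-assoc S remainder _ ⟨
        (S ++ remainder) ++ B ++ wasted ++ uncovered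
          ↭⟨ ++⁺ (++-comm S remainder) covers ⟩
        (remainder ++ S) ++ avoiding
          ≡⟨ cong (λ s → (remainder ++ s) ++ avoiding) (bucketEdges-stars v v∈blocks) ⟩
        (remainder ++ concat blocks) ++ avoiding
          ≡⟨ cong (_++ avoiding) reassemble ⟩
        through ++ avoiding
          ↭⟨ filter-++-filter∁ (v ∈?_) R ⟩
        R ∎
        where open PermutationReasoning

greedy-subhypergraph : ∀ {n} k (H : Hypergraph n) →
  Σ (Hypergraph n) (λ H′ → H′ ⊆H H × ∣E∣ H ≤ ∣E∣ H′ + (n * k + 1)
                           × BucketDecomposition (suc k) 1 H′)
greedy-subhypergraph {n} k H = H′ , H′⊆H , |E|≤ , decomposition
  where
    open GreedyPacking (greedy k (allFin n) (edges H))

    unique-packing : Unique (bucketEdges buckets ++ wasted ++ uncovered)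
    unique-packing = Unique-resp-↭ (↭-sym covers) (unique H)

    H′ : Hypergraph n
    H′ = record { edges = bucketEdges buckets ; unique = Unique-++⁻ˡ _ unique-packing }

    H′⊆H : H′ ⊆H H
    H′⊆H = All.tabulate (λ e∈H′ → ∈-resp-↭ covers (∈-++⁺ˡ e∈H′))

    decomposition : BucketDecomposition (suc k) 1 H′
    decomposition = record
      { buckets = buckets ; sizeE = proj₁ (All.unzip shapes) ; sizeX = proj₂ (All.unzip shapes)
      ; partition = ↭-refl }

    uncovered≤1 : length uncovered ≤ 1
    uncovered≤1 = Unique∧constant⇒length≤1 ⊥ uncovered
      (Unique-++⁻ʳ wasted (Unique-++⁻ʳ (bucketEdges buckets) unique-packing))
      (All.map All∉allFin⇒≡⊥ uncovered-avoids)

    |E|≤ : ∣E∣ H ≤ ∣E∣ H′ + (n * k + 1)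
    |E|≤ = begin
      length (edges H)                                    ≡⟨ ↭-length covers ⟨
      length (bucketEdges buckets ++ wasted ++ uncovered) ≡⟨ List.length-++ (bucketEdges buckets) ⟩
      ∣E∣ H′ + length (wasted ++ uncovered)
        ≡⟨ cong (∣E∣ H′ +_) (List.length-++ wasted) ⟩
      ∣E∣ H′ + (length wasted + length uncovered)
        ≤⟨ +-monoʳ-≤ (∣E∣ H′) (+-mono-≤ wasted-size uncovered≤1) ⟩
      ∣E∣ H′ + (length (allFin n) * k + 1)
        ≡⟨ cong (λ m → ∣E∣ H′ + (m * k + 1)) (List.length-tabulate {n = n} id) ⟩
      ∣E∣ H′ + (n * k + 1)                                ∎
      where open ≤-Reasoning

*-double : ∀ m k → m * (2 * k) ≡ m * k + m * k
*-double m k = trans (cong (λ k′ → m * (k + k′)) (+-identityʳ k)) (*-distribˡ-+ m k k)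

kept≥half : ∀ n k kept → n * (2 * suc k) ≤ kept + (n * k + 1) → n * (2 * suc k) ≤ 2 * kept
kept≥half zero    k _    _ = z≤n
kept≥half (suc n) k kept total≤ = begin
  N * (2 * K)     ≡⟨ *-double N K ⟩
  N * K + N * K   ≤⟨ +-mono-≤ NK≤kept NK≤kept ⟩
  kept + kept     ≡⟨ cong (kept +_) (+-identityʳ kept) ⟨
  2 * kept        ∎
  where
    open ≤-Reasoning
    N K : ℕ
    N = suc n
    K = suc k

    lost≤NK : N * k + 1 ≤ N * K
    lost≤NK = begin
      N * k + 1   ≡⟨ +-comm (N * k) 1 ⟩
      1 + N * k   ≤⟨ +-monoˡ-≤ (N * k) (s≤s (z≤n {n})) ⟩
      N + N * k   ≡⟨ *-suc N k ⟨
      N * K       ∎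

    NK≤kept : N * K ≤ kept
    NK≤kept = +-cancelʳ-≤ (N * K) (N * K) kept (begin
      N * K + N * K        ≡⟨ *-double N K ⟨
      N * (2 * K)          ≤⟨ total≤ ⟩
      kept + (N * k + 1)   ≤⟨ +-monoʳ-≤ kept lost≤NK ⟩
      kept + N * K         ∎)

lemma2p3 : (n k : ℕ) (H : Hypergraph n) → ∣E∣ H ≡ n * (2 * k) →
    Σ (Hypergraph n) (λ H' → H' ⊆H H × (n * (2 * k) ≤ 2 * ∣E∣ H') × BucketDecomposition k 1 H')
lemma2p3 n zero    H _ =
  record { edges = [] ; unique = [] } , [] , ≤-reflexive (*-zeroʳ n) ,
  record { buckets = [] ; sizeE = [] ; sizeX = [] ; partition = ↭-refl }
lemma2p3 n (suc k) H |E|≡ with H′ , H′⊆H , |E|≤ , decomposition ← greedy-subhypergraph k H =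
  H′ , H′⊆H , kept≥half n k (∣E∣ H′) (≤-trans (≤-reflexive (sym |E|≡)) |E|≤) , decomposition
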